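{- Let $X=(x_1,\dots,x_m)$ be a maximally tall traversal of the permutation matrix $P$. Then $X$ is non-extendable.
   Context: A permutation matrix is a square 0-1 matrix with exactly one 1 in each row and column. 1-entries are identified with positions $(i,j)$ ($i$ = row from the top, $j$ = column from the left); $x<_{\mathrm{v}}y$ ($x$ above $y$) means the row of $x$ is smaller than that of $y$, and $x<_{\mathrm{h}}y$ ($x$ to the left of $y$) means the column of $x$ is smaller; below/right are the reverses. $\ell_P,r_P,t_P,b_P$ denote the leftmost, rightmost, topmost and bottommost 1-entries of $P$. For $m\ge 4$, a traversal of $P$ is a sequence of distinct 1-entries $x_1,\dots,x_m$ of $P$ such that (i) $x_1=\ell_P$, $x_2=t_P$, $x_{m-1}=b_P$, $x_m=r_P$; (ii) $x_1<_{\mathrm{h}}x_3<_{\mathrm{h}}x_2<_{\mathrm{h}}x_5<_{\mathrm{h}}x_4<_{\mathrm{h}}\dots<_{\mathrm{h}}x_{m-1}<_{\mathrm{h}}x_{m-2}<_{\mathrm{h}}x_m$; (iii) $\ell_P<_{\mathrm{v}}x_4<_{\mathrm{v}}x_6<_{\mathrm{v}}\dots<_{\mathrm{v}}x_m$; (iv) $x_3<_{\mathrm{v}}x_5<_{\mathrm{v}}\dots<_{\mathrm{v}}x_{m-3}<_{\mathrm{v}}r_P$; (v) $x_s$ is below $x_{s+1}$ for each odd $s\in\{1,\dots,m-1\}$. A traversal is tall if for each even $i$ with $2\le i\le m-2$: $P$ has no 1-entry below $x_{i+1}$ and to the left of $x_i$, and no 1-entry above $x_i$ and to the right of $x_{i+1}$.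 A tall traversal $X$ is maximally tall if no tall traversal of $P$ has $X$ as a proper subsequence. A traversal $(x_1,\dots,x_m)$ is extendable if there exist an odd $s$ with $5\le s\le m-5$ and two 1-entries $y_1,y_2$ of $P$ such that $(x_1,\dots,x_s,y_1,y_2,x_{s+1},\dots,x_m)$ is a traversal of $P$; otherwise it is non-extendable. -}

module Defs where

open import Data.Nat using (ℕ; zero; suc; _+_; _∸_; _≤_; _<_; _≤ᵇ_)
open import Data.Nat using () renaming (_≡ᵇ_ to _==_)
open import Data.Nat.Properties using ()
open import Data.Bool using (Bool; true; false; if_then_else_)
open import Data.Fin as F using (Fin)
open import Data.Product using (Σ; ∃; ∃-syntax; _×_; _,_; proj₁; proj₂)
open import Data.Empty using (⊥)
open import Relation.Nullary using (¬_)
open import Relation.Binary.PropositionalEquality using (_≡_; _≢_)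

-- An n×n 0-1 matrix: P i j = true means a 1-entry in row i, column j
-- (rows numbered from the top, columns from the left; 0-based).
Matrix01 : ℕ → Set
Matrix01 n = Fin n → Fin n → Bool

IsPermutationMatrix : {n : ℕ} → Matrix01 n → Set
IsPermutationMatrix {n} P =
  ((i : Fin n) → Σ (Fin n) λ j → (P i j ≡ true) × ((j' : Fin n) → P i j' ≡ true → j' ≡ j)) ×
  ((j : Fin n) → Σ (Fin n) λ i → (P i j ≡ true) × ((i' : Fin n) → P i' j ≡ true → i' ≡ i))

Pos : ℕ → Set
Pos n = Fin n × Fin n

row col : {n : ℕ} → Pos n → Fin n
row = proj₁
col = proj₂

IsOne : {n : ℕ} → Matrix01 n → Pos n → Set
IsOne P (i , j) = P i j ≡ true

-- x <v y : x is above y ;  x <h y : x is to the left of y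
_<v_ _<h_ : {n : ℕ} → Pos n → Pos n → Set
x <v y = row x F.< row y
x <h y = col x F.< col y

IsLeftmost IsRightmost IsTopmost IsBottommost : {n : ℕ} → Matrix01 n → Pos n → Set
IsLeftmost   P e = IsOne P e × (∀ e' → IsOne P e' → col e F.≤ col e')
IsRightmost  P e = IsOne P e × (∀ e' → IsOne P e' → col e' F.≤ col e)
IsTopmost    P e = IsOne P e × (∀ e' → IsOne P e' → row e F.≤ row e')
IsBottommost P e = IsOne P e × (∀ e' → IsOne P e' → row e' F.≤ row e)

Even Odd : ℕ → Set
Even k = ∃[ t ] k ≡ t + t
Odd  k = ∃[ t ] k ≡ suc (t + t)

-- A sequence x_1,…,x_m is given by its length m and a function x : ℕ → Pos n,
-- of which only the values x 1, …, x m matter (1-based indexing as in the paper).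
Seq : ℕ → Set
Seq n = ℕ → Pos n

IsTraversal : {n : ℕ} → Matrix01 n → (m : ℕ) → Seq n → Set
IsTraversal P m x =
  -- m ≥ 4 (and m even, forced by the shape of chain (ii))
  (4 ≤ m) × Even m ×
  (∀ i → 1 ≤ i → i ≤ m → IsOne P (x i)) ×
  (∀ i j → 1 ≤ i → i ≤ m → 1 ≤ j → j ≤ m → i ≢ j → x i ≢ x j) ×
  IsLeftmost P (x 1) × IsTopmost P (x 2) ×
  IsBottommost P (x (m ∸ 1)) × IsRightmost P (x m) ×
  (x 1 <h x 3) ×
  (∀ i → Even i → 2 ≤ i → i ≤ m ∸ 2 → x (suc i) <h x i) ×
  (∀ i → Even i → 2 ≤ i → i ≤ m ∸ 4 → x i <h x (i + 3)) ×
  (x (m ∸ 2) <h x m) ×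
  (x 1 <v x 4) ×
  (∀ i → Even i → 4 ≤ i → i ≤ m ∸ 2 → x i <v x (i + 2)) ×
  (∀ i → Odd i → 3 ≤ i → i + 2 ≤ m ∸ 3 → x i <v x (i + 2)) ×
  (3 ≤ m ∸ 3 → x (m ∸ 3) <v x m) ×
  (∀ s → Odd s → 1 ≤ s → s ≤ m ∸ 1 → x (suc s) <v x s)

IsTall : {n : ℕ} → Matrix01 n → (m : ℕ) → Seq n → Set
IsTall P m x =
  IsTraversal P m x ×
  (∀ i → Even i → 2 ≤ i → i ≤ m ∸ 2 →
     (¬ (∃[ e ] IsOne P e × (x (suc i) <v e) × (e <h x i))) ×
     (¬ (∃[ e ] IsOne P e × (e <v x i) × (x (suc i) <h e))))

IsProperSubseq : {n : ℕ} → (m : ℕ) → Seq n → (m' : ℕ) → Seq n → Set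
IsProperSubseq m x m' y =
  (m < m') ×
  Σ (ℕ → ℕ) λ f → ((∀ i → 1 ≤ i → i ≤ m → (1 ≤ f i) × (f i ≤ m') × (y (f i) ≡ x i)) ×
          (∀ i j → 1 ≤ i → i < j → j ≤ m → f i < f j))

IsMaximallyTall : {n : ℕ} → Matrix01 n → (m : ℕ) → Seq n → Set
IsMaximallyTall P m x =
  IsTall P m x ×
  (¬ (∃[ m' ] ∃[ y ] IsTall P m' y × IsProperSubseq m x m' y))

insert2 : {n : ℕ} → ℕ → Pos n → Pos n → Seq n → Seq n
insert2 s y₁ y₂ x k =
  if k ≤ᵇ s then x k
  else if k == suc s then y₁
  else if k == suc (suc s) then y₂
  else x (k ∸ 2)

IsExtendable : {n : ℕ} → Matrix01 n → (m : ℕ) → Seq n → Set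
IsExtendable P m x =
  ∃[ s ] Odd s × (5 ≤ s) × (s ≤ m ∸ 5) ×
    ∃[ y₁ ] ∃[ y₂ ] IsOne P y₁ × IsOne P y₂ ×
      IsTraversal P (m + 2) (insert2 s y₁ y₂ x)

{-# OPTIONS --safe #-}
-- Suppose X becomes a traversal after inserting y₁ y₂ behind the odd position s. Call a pair
-- (a , b) admissible if inserting a b instead still gives a traversal; this only constrains a
-- and b relative to x_{s-1}, …, x_{s+2}. If an admissible pair is not tall, a witness e either
-- lies below b and left of a, and then (a , e) is admissible, or above a and right of b, and
-- then (e , b) is: tallness of X at s − 1 and s + 1 places e on the correct side of x_{s-1}
-- and x_{s+2}, strictly because distinct 1-entries of a permutation matrix share no row or
-- column. Each replacement raises a or lowers b, so the process ends in a tall admissible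
-- pair, and inserting it yields a tall traversal containing X as a proper subsequence.
module Submission where

open import Defs
open import Data.Nat using (ℕ)
open import Relation.Nullary using (¬_)
open import Data.Nat using (zero; suc; _+_; _*_; _∸_; _≤_; _<_; z≤n; s≤s; _≟_; _≤?_)
open import Data.Nat.Properties
open import Data.Nat.Induction using (<-wellFounded)
open import Data.Bool using (Bool; true; false; T; if_then_else_)
open import Data.Unit using (tt)
open import Data.Fin using (toℕ)
import Data.Fin.Properties as Fin
open import Data.Product using (∃-syntax; _×_; _,_; proj₁; proj₂)
open import Data.Sum using (_⊎_; inj₁; inj₂)
open import Data.Empty using (⊥; ⊥-elim)
open import Function using (_∘_)
open import Induction.WellFounded using (Acc; acc)
open import Relation.Binary.Definitions using (tri<; tri≈; tri>)
open import Relation.Nullary using (yes; no)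
open import Relation.Nullary.Decidable using (True; toWitness)
open import Relation.Binary.PropositionalEquality
  using (_≡_; _≢_; refl; sym; trans; cong; subst; subst₂; ≢-sym)

private variable
  n i j k : ℕ

double≡2* : ∀ t → t + t ≡ 2 * t
double≡2* t = cong (t +_) (sym (+-identityʳ t))

Even∧Odd⇒≢ : Even i → Odd j → i ≢ j
Even∧Odd⇒≢ (t , refl) (u , refl) eq =
  even≢odd t u (trans (sym (double≡2* t)) (trans eq (cong suc (double≡2* u))))

even⇒odd-suc : Even k → Odd (suc k)
even⇒odd-suc (t , refl) = t , refl

odd⇒even-suc : Odd k → Even (suc k)
odd⇒even-suc (t , refl) = suc t , cong suc (sym (+-suc t t))

parity : ∀ k → Even k ⊎ Odd k
parity zero    = inj₁ (0 , refl)
parity (suc k) with parity k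
... | inj₁ even-k = inj₂ (even⇒odd-suc even-k)
... | inj₂ odd-k  = inj₁ (odd⇒even-suc odd-k)

even≢0⇒2≤ : Even k → k ≢ 0 → 2 ≤ k
even≢0⇒2≤ {zero}        _      k≢0 = ⊥-elim (k≢0 refl)
even≢0⇒2≤ {suc zero}    even-1 _   = ⊥-elim (Even∧Odd⇒≢ even-1 (0 , refl) refl)
even≢0⇒2≤ {suc (suc k)} _      _   = s≤s (s≤s z≤n)

even-pred² : Even (suc (suc k)) → Even k
even-pred² {k} even-k+2 with parity k
... | inj₁ even-k = even-k
... | inj₂ odd-k  = ⊥-elim (Even∧Odd⇒≢ even-k+2 (even⇒odd-suc (odd⇒even-suc odd-k)) refl)

+≤⇒≤∸ : ∀ {m} j → j + i ≤ m → i ≤ m ∸ j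
+≤⇒≤∸ {i} {m} j j+i≤m = m+n≤o⇒m≤o∸n i (subst (_≤ m) (+-comm j i) j+i≤m)

if-T : ∀ {A : Set} {c : Bool} {u v : A} → T c → (if c then u else v) ≡ u
if-T {c = true} _ = refl

if-¬T : ∀ {A : Set} {c : Bool} {u v : A} → ¬ T c → (if c then u else v) ≡ v
if-¬T {c = false} _ = refl
if-¬T {c = true}  h = ⊥-elim (h tt)

module _ (s : ℕ) (a b : Pos n) (x : Seq n) where

  insert2-before : k ≤ s → insert2 s a b x k ≡ x k
  insert2-before k≤s = if-T (≤⇒≤ᵇ k≤s)

  insert2-first : insert2 s a b x (suc s) ≡ a
  insert2-first = trans (if-¬T (<⇒≱ (n<1+n s) ∘ ≤ᵇ⇒≤ (suc s) s)) (if-T (≡⇒≡ᵇ s s refl))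

  insert2-second : insert2 s a b x (suc (suc s)) ≡ b
  insert2-second = trans (if-¬T (<⇒≱ (m<n+m s (s≤s z≤n)) ∘ ≤ᵇ⇒≤ (2 + s) s))
                  (trans (if-¬T (1+n≢n ∘ ≡ᵇ⇒≡ (2 + s) (1 + s))) (if-T (≡⇒≡ᵇ s s refl)))

  insert2-after : suc (suc s) < k → insert2 s a b x k ≡ x (k ∸ 2)
  insert2-after {k} s+2<k = trans (if-¬T (<⇒≱ s<k ∘ ≤ᵇ⇒≤ k s))
                           (trans (if-¬T (>⇒≢ (<-trans (n<1+n _) s+2<k) ∘ ≡ᵇ⇒≡ k (1 + s)))
                                  (if-¬T (>⇒≢ s+2<k ∘ ≡ᵇ⇒≡ k (2 + s))))
    where s<k = <-trans (m<n+m s (s≤s z≤n)) s+2<k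

insert2-outside : ∀ s {a b a′ b′ : Pos n} (x : Seq n) →
  k ≢ suc s → k ≢ suc (suc s) → insert2 s a b x k ≡ insert2 s a′ b′ x k
insert2-outside {k = k} s x k≢s+1 k≢s+2 with k ≤? s
... | yes k≤s = trans (insert2-before s _ _ x k≤s) (sym (insert2-before s _ _ x k≤s))
... | no k≰s  = trans (insert2-after s _ _ x s+2<k) (sym (insert2-after s _ _ x s+2<k))
  where
  s+2<k : suc (suc s) < k
  s+2<k = ≤∧≢⇒< (≤∧≢⇒< (≰⇒> k≰s) (k≢s+1 ∘ sym)) (k≢s+2 ∘ sym)

module Traversal {P : Matrix01 n} {m : ℕ} {x : Seq n} (T : IsTraversal P m x) where

  ones : ∀ i → 1 ≤ i → i ≤ m → IsOne P (x i)
  ones = let (_ , _ , h , _) = T in h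

  ii-back : ∀ i → Even i → 2 ≤ i → i ≤ m ∸ 2 → x (suc i) <h x i
  ii-back = let (_ , _ , _ , _ , _ , _ , _ , _ , _ , h , _) = T in h

  ii-jump : ∀ i → Even i → 2 ≤ i → i ≤ m ∸ 4 → x i <h x (i + 3)
  ii-jump = let (_ , _ , _ , _ , _ , _ , _ , _ , _ , _ , h , _) = T in h

  iii-step : ∀ i → Even i → 4 ≤ i → i ≤ m ∸ 2 → x i <v x (i + 2)
  iii-step = let (_ , _ , _ , _ , _ , _ , _ , _ , _ , _ , _ , _ , _ , h , _) = T in h

  iv-step : ∀ i → Odd i → 3 ≤ i → i + 2 ≤ m ∸ 3 → x i <v x (i + 2)
  iv-step = let (_ , _ , _ , _ , _ , _ , _ , _ , _ , _ , _ , _ , _ , _ , h , _) = T in h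

  v-step : ∀ i → Odd i → 1 ≤ i → i ≤ m ∸ 1 → x (suc i) <v x i
  v-step = let (_ , _ , _ , _ , _ , _ , _ , _ , _ , _ , _ , _ , _ , _ , _ , _ , h) = T in h

module _ {P : Matrix01 n} (perm : IsPermutationMatrix P) {u v : Pos n}
         (one-u : IsOne P u) (one-v : IsOne P v) where

  same-col⇒same-row : col u ≡ col v → row u ≡ row v
  same-col⇒same-row refl =
    let (_ , _ , unique) = proj₂ perm (col u) in trans (unique (row u) one-u) (sym (unique (row v) one-v))

  same-row⇒same-col : row u ≡ row v → col u ≡ col v
  same-row⇒same-col refl =
    let (_ , _ , unique) = proj₁ perm (row u) in trans (unique (col u) one-u) (sym (unique (col v) one-v))

  ≯h⇒<h : row u ≢ row v → ¬ (v <h u) → u <h v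
  ≯h⇒<h rows≢ v≮u = Fin.≤∧≢⇒< (≮⇒≥ v≮u) (rows≢ ∘ same-col⇒same-row)

  ≯v⇒<v : col u ≢ col v → ¬ (v <v u) → u <v v
  ≯v⇒<v cols≢ v≮u = Fin.≤∧≢⇒< (≮⇒≥ v≮u) (cols≢ ∘ same-row⇒same-col)

pairSwap : ℕ → ℕ
pairSwap zero          = 1
pairSwap (suc zero)    = 0
pairSwap (suc (suc k)) = suc (suc (pairSwap k))

pairSwap-involutive : ∀ k → pairSwap (pairSwap k) ≡ k
pairSwap-involutive zero          = refl
pairSwap-involutive (suc zero)    = refl
pairSwap-involutive (suc (suc k)) = cong (suc ∘ suc) (pairSwap-involutive k)

pairSwap≤suc : ∀ k → pairSwap k ≤ suc k
pairSwap≤suc zero          = ≤-refl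
pairSwap≤suc (suc zero)    = z≤n
pairSwap≤suc (suc (suc k)) = s≤s (s≤s (pairSwap≤suc k))

pairSwap-even : Even k → pairSwap k ≡ suc k
pairSwap-even {zero}        _      = refl
pairSwap-even {suc zero}    even-1 = ⊥-elim (Even∧Odd⇒≢ even-1 (0 , refl) refl)
pairSwap-even {suc (suc k)} even-k = cong (suc ∘ suc) (pairSwap-even (even-pred² even-k))

pairSwap-suc-even : Even k → pairSwap (suc k) ≡ k
pairSwap-suc-even {k} even-k = trans (cong pairSwap (sym (pairSwap-even even-k))) (pairSwap-involutive k)

module ColumnChain {x : Seq n} {m : ℕ} (4≤m : 4 ≤ m) (even-m : Even m)
  (first : x 1 <h x 3)
  (back : ∀ i → Even i → 2 ≤ i → i ≤ m ∸ 2 → x (suc i) <h x i)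
  (jump : ∀ i → Even i → 2 ≤ i → i ≤ m ∸ 4 → x i <h x (i + 3))
  (last : x (m ∸ 2) <h x m) where

  -- the chain (ii) lists x (σ 1) <h x (σ 2) <h … <h x (σ m)
  σ : ℕ → ℕ
  σ p with p ≟ 1 | p ≟ m
  ... | no _ | no _ = pairSwap p
  ... | _    | _    = p

  σ-m : σ m ≡ m
  σ-m with m ≟ 1 | m ≟ m
  ... | no _  | no m≢m = ⊥-elim (m≢m refl)
  ... | yes _ | _      = refl
  ... | no _  | yes _  = refl

  σ-inner : ∀ p → p ≢ 1 → p ≢ m → σ p ≡ pairSwap p
  σ-inner p p≢1 p≢m with p ≟ 1 | p ≟ m
  ... | no _  | no _   = refl
  ... | yes e | _      = ⊥-elim (p≢1 e)
  ... | no _  | yes e  = ⊥-elim (p≢m e)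

  <h-by : ∀ {i i′ j j′} → i ≡ i′ → j ≡ j′ → x i′ <h x j′ → x i <h x j
  <h-by refl refl i<j = i<j

  chain-step : ∀ p → 1 ≤ p → suc p ≤ m → x (σ p) <h x (σ (suc p))
  chain-step (suc q) _ p<m with q ≟ 0 | m ≟ suc (suc q) | parity q
  ... | yes refl | _ | _ = <h-by refl (σ-inner 2 (λ ()) (<⇒≢ (≤-trans (n≤1+n 3) 4≤m))) first
  ... | no q≢0 | yes m≡q+2 | _ =
    <h-by (trans (σ-inner (suc q) (q≢0 ∘ suc-injective) (<⇒≢ p<m)) (pairSwap-suc-even even-q))
         (trans (cong σ (sym m≡q+2)) σ-m)
         (subst (λ r → x r <h x m) (cong (_∸ 2) m≡q+2) last)
    where
    even-q : Even q
    even-q = even-pred² (subst Even m≡q+2 even-m)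
  ... | no q≢0 | no m≢q+2 | inj₂ odd-q =
    <h-by (trans (σ-inner (suc q) (q≢0 ∘ suc-injective) (<⇒≢ p<m)) (pairSwap-even even-p))
         (trans (σ-inner (suc (suc q)) (λ ()) (m≢q+2 ∘ sym)) (pairSwap-suc-even even-p))
         (back (suc q) even-p (s≤s (n≢0⇒n>0 q≢0)) (+≤⇒≤∸ 2 (≤∧≢⇒< p<m (m≢q+2 ∘ sym))))
    where
    even-p : Even (suc q)
    even-p = odd⇒even-suc odd-q
  ... | no q≢0 | no m≢q+2 | inj₁ even-q =
    <h-by (trans (σ-inner (suc q) (q≢0 ∘ suc-injective) (<⇒≢ p<m)) (pairSwap-suc-even even-q))
         (trans (σ-inner (suc (suc q)) (λ ()) (m≢q+2 ∘ sym))
                (trans (cong (suc ∘ suc) (pairSwap-even even-q)) (+-comm 3 q)))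
         (jump q even-q (even≢0⇒2≤ even-q q≢0) (+≤⇒≤∸ 4 (≤∧≢⇒< (≤∧≢⇒< p<m (m≢q+2 ∘ sym)) q+3≢m)))
    where
    q+3≢m : 3 + q ≢ m
    q+3≢m = Even∧Odd⇒≢ even-m (even⇒odd-suc (odd⇒even-suc (even⇒odd-suc even-q))) ∘ sym

  chain-mono : ∀ {p q} → 1 ≤ p → p < q → q ≤ m → x (σ p) <h x (σ q)
  chain-mono {p} {suc q} 1≤p p<q+1 q+1≤m with p ≟ q
  ... | yes refl = chain-step p 1≤p q+1≤m
  ... | no p≢q   = <-trans (chain-mono 1≤p (≤∧≢⇒< (≤-pred p<q+1) p≢q) (≤-trans (n≤1+n q) q+1≤m))
                           (chain-step q (≤-trans 1≤p (≤-pred p<q+1)) q+1≤m)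

  module _ {p} (1≤p : 1 ≤ p) (p≤m : p ≤ m) (p≢1 : p ≢ 1) (p≢m : p ≢ m) where

    pairSwap-inner≢1 : pairSwap p ≢ 1
    pairSwap-inner≢1 swap≡1 = <⇒≢ 1≤p (sym (trans (sym (pairSwap-involutive p)) (cong pairSwap swap≡1)))

    pairSwap-inner≢m : pairSwap p ≢ m
    pairSwap-inner≢m swap≡m = <⇒≱ (s≤s p≤m)
      (≤-reflexive (trans (sym (pairSwap-even even-m)) (trans (cong pairSwap (sym swap≡m)) (pairSwap-involutive p))))

    pairSwap-inner-bounded : 1 ≤ pairSwap p × pairSwap p ≤ m
    pairSwap-inner-bounded =
        n≢0⇒n>0 (λ swap≡0 → p≢1 (trans (sym (pairSwap-involutive p)) (cong pairSwap swap≡0)))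
      , ≤-trans (pairSwap≤suc p) (≤∧≢⇒< p≤m p≢m)

  σ-bounded : ∀ {p} → 1 ≤ p → p ≤ m → 1 ≤ σ p × σ p ≤ m
  σ-bounded {p} 1≤p p≤m with p ≟ 1 | p ≟ m
  ... | no p≢1 | no p≢m = pairSwap-inner-bounded 1≤p p≤m p≢1 p≢m
  ... | yes _  | _      = 1≤p , p≤m
  ... | no _   | yes _  = 1≤p , p≤m

  σ-involutive : ∀ {p} → 1 ≤ p → p ≤ m → σ (σ p) ≡ p
  σ-involutive {p} 1≤p p≤m with 1 ≟ p | m ≟ p
  ... | yes refl | _        = refl
  ... | no _     | yes refl = trans (cong σ σ-m) σ-m
  ... | no 1≢p   | no m≢p   =
    trans (cong σ (σ-inner p p≢1 p≢m))
          (trans (σ-inner (pairSwap p) (pairSwap-inner≢1 1≤p p≤m p≢1 p≢m) (pairSwap-inner≢m 1≤p p≤m p≢1 p≢m))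
                 (pairSwap-involutive p))
    where
    p≢1 = ≢-sym 1≢p
    p≢m = ≢-sym m≢p

  σ-ordered⇒distinct : ∀ {i j} → 1 ≤ i → i ≤ m → 1 ≤ j → j ≤ m → σ i < σ j → x i ≢ x j
  σ-ordered⇒distinct 1≤i i≤m 1≤j j≤m σi<σj xi≡xj =
    <⇒≢ (<h-by (sym (σ-involutive 1≤i i≤m)) (sym (σ-involutive 1≤j j≤m))
                (chain-mono (proj₁ (σ-bounded 1≤i i≤m)) σi<σj (proj₂ (σ-bounded 1≤j j≤m))))
        (cong (toℕ ∘ col) xi≡xj)

  distinct : ∀ i j → 1 ≤ i → i ≤ m → 1 ≤ j → j ≤ m → i ≢ j → x i ≢ x j
  distinct i j 1≤i i≤m 1≤j j≤m i≢j with <-cmp (σ i) (σ j)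
  ... | tri< σi<σj _ _ = σ-ordered⇒distinct 1≤i i≤m 1≤j j≤m σi<σj
  ... | tri> _ _ σj<σi = ≢-sym (σ-ordered⇒distinct 1≤j j≤m 1≤i i≤m σj<σi)
  ... | tri≈ _ σi≡σj _ = ⊥-elim (i≢j (trans (sym (σ-involutive 1≤i i≤m))
                                            (trans (cong σ σi≡σj) (σ-involutive 1≤j j≤m))))

TallPair : Matrix01 n → Pos n → Pos n → Set
TallPair P u v = (¬ (∃[ e ] IsOne P e × (v <v e) × (e <h u))) × (¬ (∃[ e ] IsOne P e × (e <v u) × (v <h e)))

-- k = s − 1, where s is the odd position after which y₁ y₂ are inserted
module Insertion
  {P : Matrix01 n} (perm : IsPermutationMatrix P)
  {m : ℕ} {x : Seq n} (TX : IsTraversal P m x)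
  (tallX : ∀ i → Even i → 2 ≤ i → i ≤ m ∸ 2 → TallPair P (x i) (x (suc i)))
  (maximal : ¬ (∃[ m′ ] ∃[ y ] IsTall P m′ y × IsProperSubseq m x m′ y))
  (k : ℕ) (even-k : Even k) (4≤k : 4 ≤ k) (k+6≤m : 6 + k ≤ m)
  {y₁ y₂ : Pos n} (one-y₁ : IsOne P y₁) (one-y₂ : IsOne P y₂)
  (TY : IsTraversal P (2 + m) (insert2 (suc k) y₁ y₂ x))
  where

  s M : ℕ
  s = suc k
  M = 2 + m

  xₛ₋₁ xₛ xₛ₊₁ xₛ₊₂ : Pos n
  xₛ₋₁ = x k
  xₛ   = x s
  xₛ₊₁ = x (1 + s)
  xₛ₊₂ = x (2 + s)

  z : Pos n → Pos n → Seq n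
  z a b = insert2 s a b x

  module X = Traversal TX
  module Y = Traversal TY

  j+k≤m : ∀ j {j≤6 : True (j ≤? 6)} → j + k ≤ m
  j+k≤m j {j≤6} = ≤-trans (+-monoˡ-≤ k (toWitness j≤6)) k+6≤m

  2≤k : 2 ≤ k
  2≤k = ≤-trans (s≤s (s≤s z≤n)) 4≤k

  2≤s+1 : 2 ≤ 1 + s
  2≤s+1 = ≤-trans 2≤k (m≤n+m k 2)

  k≤m∸2 : k ≤ m ∸ 2
  k≤m∸2 = +≤⇒≤∸ 2 (j+k≤m 2)

  s+1≤m∸2 : 1 + s ≤ m ∸ 2
  s+1≤m∸2 = +≤⇒≤∸ 2 (j+k≤m 4)

  s+2<m : 2 + s < m
  s+2<m = j+k≤m 4

  odd-s : Odd s
  odd-s = even⇒odd-suc even-k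

  even-s+1 : Even (1 + s)
  even-s+1 = odd⇒even-suc odd-s

  odd-s+2 : Odd (2 + s)
  odd-s+2 = even⇒odd-suc even-s+1

  xₛ<ₕxₛ₋₁ : xₛ <h xₛ₋₁
  xₛ<ₕxₛ₋₁ = X.ii-back k even-k 2≤k k≤m∸2

  xₛ₊₂<ₕxₛ₊₁ : xₛ₊₂ <h xₛ₊₁
  xₛ₊₂<ₕxₛ₊₁ = X.ii-back (1 + s) even-s+1 2≤s+1 s+1≤m∸2

  xₛ₊₁<ᵥxₛ : xₛ₊₁ <v xₛ
  xₛ₊₁<ᵥxₛ = X.v-step s odd-s (s≤s z≤n) (+≤⇒≤∸ 1 (j+k≤m 2))

  one-xₛ₋₁ : IsOne P xₛ₋₁
  one-xₛ₋₁ = X.ones k (≤-trans (s≤s z≤n) 4≤k) (≤-trans (n≤1+n k) (j+k≤m 1))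

  one-xₛ₊₂ : IsOne P xₛ₊₂
  one-xₛ₊₂ = X.ones (2 + s) (s≤s z≤n) (j+k≤m 3)

  tallₛ₋₁ : TallPair P xₛ₋₁ xₛ
  tallₛ₋₁ = tallX k even-k 2≤k k≤m∸2

  tallₛ₊₁ : TallPair P xₛ₊₁ xₛ₊₂
  tallₛ₊₁ = tallX (1 + s) even-s+1 2≤s+1 s+1≤m∸2

  -- the traversal conditions on z a b that involve a or b and are not implied by the others
  record Admissible (a b : Pos n) : Set where
    field
      one-a   : IsOne P a
      one-b   : IsOne P b
      b<ₕa    : b <h a
      xₛ₋₁<ₕb : xₛ₋₁ <h b
      a<ₕxₛ₊₂ : a <h xₛ₊₂
      xₛ₋₁<ᵥa : xₛ₋₁ <v a
      a<ᵥxₛ₊₁ : a <v xₛ₊₁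
      xₛ<ᵥb   : xₛ <v b
      b<ᵥxₛ₊₂ : b <v xₛ₊₂

  lower-b : ∀ {a b e} → Admissible a b → IsOne P e → b <v e → e <h a → Admissible a e
  lower-b {a} {b} {e} adm one-e b<ᵥe e<ₕa =
    record { one-a = one-a ; one-b = one-e ; b<ₕa = e<ₕa ; xₛ₋₁<ₕb = xₛ₋₁<ₕe ; a<ₕxₛ₊₂ = a<ₕxₛ₊₂
           ; xₛ₋₁<ᵥa = xₛ₋₁<ᵥa ; a<ᵥxₛ₊₁ = a<ᵥxₛ₊₁ ; xₛ<ᵥb = xₛ<ᵥe ; b<ᵥxₛ₊₂ = e<ᵥxₛ₊₂ }
    where
    open Admissible adm
    xₛ<ᵥe : xₛ <v e
    xₛ<ᵥe = <-trans xₛ<ᵥb b<ᵥe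
    xₛ₋₁<ₕe : xₛ₋₁ <h e
    xₛ₋₁<ₕe = ≯h⇒<h perm one-xₛ₋₁ one-e
      (Fin.<⇒≢ (<-trans xₛ₋₁<ᵥa (<-trans a<ᵥxₛ₊₁ (<-trans xₛ₊₁<ᵥxₛ xₛ<ᵥe))))
      (λ e<ₕxₛ₋₁ → proj₁ tallₛ₋₁ (e , one-e , xₛ<ᵥe , e<ₕxₛ₋₁))
    e<ᵥxₛ₊₂ : e <v xₛ₊₂
    e<ᵥxₛ₊₂ = ≯v⇒<v perm one-e one-xₛ₊₂
      (Fin.<⇒≢ (<-trans e<ₕa a<ₕxₛ₊₂))
      (λ xₛ₊₂<ᵥe → proj₁ tallₛ₊₁ (e , one-e , xₛ₊₂<ᵥe , <-trans e<ₕa (<-trans a<ₕxₛ₊₂ xₛ₊₂<ₕxₛ₊₁)))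

  raise-a : ∀ {a b e} → Admissible a b → IsOne P e → e <v a → b <h e → Admissible e b
  raise-a {a} {b} {e} adm one-e e<ᵥa b<ₕe =
    record { one-a = one-e ; one-b = one-b ; b<ₕa = b<ₕe ; xₛ₋₁<ₕb = xₛ₋₁<ₕb ; a<ₕxₛ₊₂ = e<ₕxₛ₊₂
           ; xₛ₋₁<ᵥa = xₛ₋₁<ᵥe ; a<ᵥxₛ₊₁ = e<ᵥxₛ₊₁ ; xₛ<ᵥb = xₛ<ᵥb ; b<ᵥxₛ₊₂ = b<ᵥxₛ₊₂ }
    where
    open Admissible adm
    e<ᵥxₛ₊₁ : e <v xₛ₊₁
    e<ᵥxₛ₊₁ = <-trans e<ᵥa a<ᵥxₛ₊₁
    e<ₕxₛ₊₂ : e <h xₛ₊₂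
    e<ₕxₛ₊₂ = ≯h⇒<h perm one-e one-xₛ₊₂
      (Fin.<⇒≢ (<-trans e<ᵥxₛ₊₁ (<-trans xₛ₊₁<ᵥxₛ (<-trans xₛ<ᵥb b<ᵥxₛ₊₂))))
      (λ xₛ₊₂<ₕe → proj₂ tallₛ₊₁ (e , one-e , e<ᵥxₛ₊₁ , xₛ₊₂<ₕe))
    xₛ₋₁<ᵥe : xₛ₋₁ <v e
    xₛ₋₁<ᵥe = ≯v⇒<v perm one-xₛ₋₁ one-e
      (Fin.<⇒≢ (<-trans xₛ₋₁<ₕb b<ₕe))
      (λ e<ᵥxₛ₋₁ → proj₂ tallₛ₋₁ (e , one-e , e<ᵥxₛ₋₁ , <-trans xₛ<ₕxₛ₋₁ (<-trans xₛ₋₁<ₕb b<ₕe)))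

  module _ {a b : Pos n} where

    z-s₋₁ : z a b k ≡ xₛ₋₁
    z-s₋₁ = insert2-before s a b x (n≤1+n k)

    z-s : z a b s ≡ xₛ
    z-s = insert2-before s a b x ≤-refl

    z-s₊₁ : z a b (1 + s) ≡ a
    z-s₊₁ = insert2-first s a b x

    z-s₊₂ : z a b (2 + s) ≡ b
    z-s₊₂ = insert2-second s a b x

    z-s₊₃ : z a b (3 + s) ≡ xₛ₊₁
    z-s₊₃ = insert2-after s a b x ≤-refl

    z-s₊₄ : z a b (4 + s) ≡ xₛ₊₂
    z-s₊₄ = insert2-after s a b x (n≤1+n _)

    z-+comm : ∀ i j → z a b (i + j) ≡ z a b (j + i)
    z-+comm i j = cong (z a b) (+-comm i j)

  initial : Admissible y₁ y₂
  initial = record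
    { one-a   = one-y₁
    ; one-b   = one-y₂
    ; b<ₕa    = subst₂ _<h_ z-s₊₂ z-s₊₁ (Y.ii-back (1 + s) even-s+1 2≤s+1 (j+k≤m 2))
    ; xₛ₋₁<ₕb = subst₂ _<h_ z-s₋₁ (trans (z-+comm k 3) z-s₊₂) (Y.ii-jump k even-k 2≤k k≤m∸2)
    ; a<ₕxₛ₊₂ = subst₂ _<h_ z-s₊₁ (trans (z-+comm (1 + s) 3) z-s₊₄) (Y.ii-jump (1 + s) even-s+1 2≤s+1 s+1≤m∸2)
    ; xₛ₋₁<ᵥa = subst₂ _<v_ z-s₋₁ (trans (z-+comm k 2) z-s₊₁) (Y.iii-step k even-k 4≤k (j+k≤m 0))
    ; a<ᵥxₛ₊₁ = subst₂ _<v_ z-s₊₁ (trans (z-+comm (1 + s) 2) z-s₊₃)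
                  (Y.iii-step (1 + s) even-s+1 (≤-trans 4≤k (m≤n+m k 2)) (j+k≤m 2))
    ; xₛ<ᵥb   = subst₂ _<v_ z-s (trans (z-+comm s 2) z-s₊₂)
                  (Y.iv-step s odd-s (≤-trans (s≤s (s≤s (s≤s z≤n))) (≤-trans 4≤k (n≤1+n k)))
                     (subst (_≤ m ∸ 1) (+-comm 2 s) (+≤⇒≤∸ 1 (j+k≤m 4))))
    ; b<ᵥxₛ₊₂ = subst₂ _<v_ z-s₊₂ (trans (z-+comm (2 + s) 2) z-s₊₄)
                  (Y.iv-step (2 + s) odd-s+2 (≤-trans (s≤s (s≤s (s≤s z≤n))) (≤-trans 4≤k (m≤n+m k 3)))
                     (subst (_≤ m ∸ 1) (+-comm 2 (2 + s)) (+≤⇒≤∸ 1 (j+k≤m 6))))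
    }

  Outside : ℕ → Set
  Outside j = j ≢ 1 + s × j ≢ 2 + s

  outside-≤ : j ≤ s → Outside j
  outside-≤ j≤s = <⇒≢ (s≤s j≤s) , <⇒≢ (≤-trans (s≤s j≤s) (n≤1+n _))

  outside-> : 2 + s < j → Outside j
  outside-> s+2<j = >⇒≢ (<-trans (n<1+n _) s+2<j) , >⇒≢ s+2<j

  even-outside : Even j → j ≢ 1 + s → Outside j
  even-outside even-j j≢s+1 = j≢s+1 , Even∧Odd⇒≢ even-j odd-s+2

  odd-outside : Odd j → j ≢ 2 + s → Outside j
  odd-outside odd-j j≢s+2 = ≢-sym (Even∧Odd⇒≢ even-s+1 odd-j) , j≢s+2

  module _ {a b : Pos n} (adm : Admissible a b) where
    open Admissible adm

    from-Y : (R : Pos n → Set) → Outside i → R (z y₁ y₂ i) → R (z a b i)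
    from-Y R (≢s+1 , ≢s+2) = subst R (insert2-outside s x ≢s+1 ≢s+2)

    from-Y₂ : (R : Pos n → Pos n → Set) → Outside i → Outside j →
              R (z y₁ y₂ i) (z y₁ y₂ j) → R (z a b i) (z a b j)
    from-Y₂ R (≢s+1 , ≢s+2) (≢′s+1 , ≢′s+2) =
      subst₂ R (insert2-outside s x ≢s+1 ≢s+2) (insert2-outside s x ≢′s+1 ≢′s+2)

    z-ones : ∀ i → 1 ≤ i → i ≤ M → IsOne P (z a b i)
    z-ones i 1≤i i≤M with i ≟ 1 + s | i ≟ 2 + s
    ... | yes refl | _        = subst (IsOne P) (sym z-s₊₁) one-a
    ... | no _     | yes refl = subst (IsOne P) (sym z-s₊₂) one-b
    ... | no ≢s+1  | no ≢s+2  = from-Y (IsOne P) (≢s+1 , ≢s+2) (Y.ones i 1≤i i≤M)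

    z-ii-back : ∀ i → Even i → 2 ≤ i → i ≤ M ∸ 2 → z a b (suc i) <h z a b i
    z-ii-back i even-i 2≤i i≤ with i ≟ 1 + s
    ... | yes refl = subst₂ _<h_ (sym z-s₊₂) (sym z-s₊₁) b<ₕa
    ... | no ≢s+1  = from-Y₂ _<h_ (odd-outside (even⇒odd-suc even-i) (≢s+1 ∘ suc-injective))
                                  (even-outside even-i ≢s+1) (Y.ii-back i even-i 2≤i i≤)

    z-ii-jump : ∀ i → Even i → 2 ≤ i → i ≤ M ∸ 4 → z a b i <h z a b (i + 3)
    z-ii-jump i even-i 2≤i i≤ with i ≟ k | i ≟ 1 + s
    ... | yes refl | _        = subst₂ _<h_ (sym z-s₋₁) (sym (trans (z-+comm k 3) z-s₊₂)) xₛ₋₁<ₕb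
    ... | no _     | yes refl = subst₂ _<h_ (sym z-s₊₁) (sym (trans (z-+comm (1 + s) 3) z-s₊₄)) a<ₕxₛ₊₂
    ... | no ≢k    | no ≢s+1  = from-Y₂ _<h_ (even-outside even-i ≢s+1)
      (odd-outside (subst Odd (+-comm 3 i) (even⇒odd-suc (odd⇒even-suc (even⇒odd-suc even-i))))
                   (≢k ∘ +-cancelʳ-≡ 3 i k ∘ (λ e → trans e (+-comm 3 k))))
      (Y.ii-jump i even-i 2≤i i≤)

    z-iii-step : ∀ i → Even i → 4 ≤ i → i ≤ M ∸ 2 → z a b i <v z a b (i + 2)
    z-iii-step i even-i 4≤i i≤ with i ≟ k | i ≟ 1 + s
    ... | yes refl | _        = subst₂ _<v_ (sym z-s₋₁) (sym (trans (z-+comm k 2) z-s₊₁)) xₛ₋₁<ᵥa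
    ... | no _     | yes refl = subst₂ _<v_ (sym z-s₊₁) (sym (trans (z-+comm (1 + s) 2) z-s₊₃)) a<ᵥxₛ₊₁
    ... | no ≢k    | no ≢s+1  = from-Y₂ _<v_ (even-outside even-i ≢s+1)
      (even-outside (subst Even (+-comm 2 i) (odd⇒even-suc (even⇒odd-suc even-i)))
                    (≢k ∘ +-cancelʳ-≡ 2 i k ∘ (λ e → trans e (+-comm 2 k))))
      (Y.iii-step i even-i 4≤i i≤)

    z-iv-step : ∀ i → Odd i → 3 ≤ i → i + 2 ≤ M ∸ 3 → z a b i <v z a b (i + 2)
    z-iv-step i odd-i 3≤i i≤ with i ≟ s | i ≟ 2 + s
    ... | yes refl | _        = subst₂ _<v_ (sym z-s) (sym (trans (z-+comm s 2) z-s₊₂)) xₛ<ᵥb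
    ... | no _     | yes refl = subst₂ _<v_ (sym z-s₊₂) (sym (trans (z-+comm (2 + s) 2) z-s₊₄)) b<ᵥxₛ₊₂
    ... | no ≢s    | no ≢s+2  = from-Y₂ _<v_ (odd-outside odd-i ≢s+2)
      (odd-outside (subst Odd (+-comm 2 i) (even⇒odd-suc (odd⇒even-suc odd-i)))
                   (≢s ∘ +-cancelʳ-≡ 2 i s ∘ (λ e → trans e (+-comm 2 s))))
      (Y.iv-step i odd-i 3≤i i≤)

    z-v-step : ∀ i → Odd i → 1 ≤ i → i ≤ M ∸ 1 → z a b (suc i) <v z a b i
    z-v-step i odd-i 1≤i i≤ with i ≟ s | i ≟ 2 + s
    ... | yes refl | _        = subst₂ _<v_ (sym z-s₊₁) (sym z-s) (<-trans a<ᵥxₛ₊₁ xₛ₊₁<ᵥxₛ)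
    ... | no _     | yes refl = subst₂ _<v_ (sym z-s₊₃) (sym z-s₊₂) (<-trans xₛ₊₁<ᵥxₛ xₛ<ᵥb)
    ... | no ≢s    | no ≢s+2  = from-Y₂ _<v_ (even-outside (odd⇒even-suc odd-i) (≢s ∘ suc-injective))
                                  (odd-outside odd-i ≢s+2) (Y.v-step i odd-i 1≤i i≤)

    z-traversal : IsTraversal P M (z a b)
    z-traversal =
      let (4≤M , even-M , _ , _ , leftmost , topmost , bottommost , rightmost ,
           first , _ , _ , last , v-first , _ , _ , v-last , _) = TY
          first′ : z a b 1 <h z a b 3
          first′ = from-Y₂ _<h_ (outside-≤ 1≤s) (outside-≤ 3≤s) first
          last′ : z a b m <h z a b M
          last′  = from-Y₂ _<h_ (outside-> s+2<m) (outside-> s+2<M) last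
      in  4≤M , even-M , z-ones ,
          ColumnChain.distinct 4≤M even-M first′ z-ii-back z-ii-jump last′ ,
          from-Y {i = 1} (IsLeftmost P) (outside-≤ 1≤s) leftmost ,
          from-Y {i = 2} (IsTopmost P) (outside-≤ 2≤s) topmost ,
          from-Y {i = 1 + m} (IsBottommost P) (outside-> (<-trans s+2<m (n<1+n m))) bottommost ,
          from-Y {i = M} (IsRightmost P) (outside-> s+2<M) rightmost ,
          first′ , z-ii-back , z-ii-jump , last′ ,
          from-Y₂ _<v_ (outside-≤ 1≤s) (outside-≤ 4≤s) v-first ,
          z-iii-step , z-iv-step ,
          (λ h → from-Y₂ _<v_ (outside-> (+≤⇒≤∸ 1 (j+k≤m 5)))
                              (outside-> s+2<M) (v-last h)) ,
          z-v-step
      where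
      s+2<M : 2 + s < M
      s+2<M = <-trans s+2<m (m<n+m m (s≤s z≤n))
      4≤s : 4 ≤ s
      4≤s = ≤-trans 4≤k (n≤1+n k)
      3≤s : 3 ≤ s
      3≤s = ≤-trans (n≤1+n 3) 4≤s
      2≤s : 2 ≤ s
      2≤s = ≤-trans (n≤1+n 2) 3≤s
      1≤s : 1 ≤ s
      1≤s = s≤s z≤n

  module _ {a b : Pos n} (tall-ab : TallPair P a b) where

    z-tall-shifted : ∀ i → Even i → i ≤ m → 2 + s < i → TallPair P (z a b i) (z a b (suc i))
    z-tall-shifted (suc zero)    _ _ (s≤s ())
    z-tall-shifted (suc (suc j)) even-j+2 j+2≤m s+2<j+2 =
      subst₂ (TallPair P) (sym (insert2-after s a b x s+2<j+2))
                          (sym (insert2-after s a b x (<-trans s+2<j+2 (n<1+n _))))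
             (tallX j (even-pred² even-j+2) (≤-trans 2≤s+1 (≤-pred (≤-pred s+2<j+2))) (+≤⇒≤∸ 2 j+2≤m))

    z-tall : ∀ i → Even i → 2 ≤ i → i ≤ M ∸ 2 → TallPair P (z a b i) (z a b (suc i))
    z-tall i even-i 2≤i i≤m with i ≟ 1 + s | i ≤? s
    ... | yes refl | _     = subst₂ (TallPair P) (sym z-s₊₁) (sym z-s₊₂) tall-ab
    ... | no _     | yes i≤s =
      subst₂ (TallPair P) (sym (insert2-before s a b x i≤s)) (sym (insert2-before s a b x i<s))
             (tallX i even-i 2≤i (≤-trans i≤s (≤-trans (n≤1+n s) s+1≤m∸2)))
      where
      i<s : i < s
      i<s = ≤∧≢⇒< i≤s (Even∧Odd⇒≢ even-i odd-s)
    ... | no ≢s+1  | no i≰s  = z-tall-shifted i even-i i≤m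
      (≤∧≢⇒< (≤∧≢⇒< (≰⇒> i≰s) (≢s+1 ∘ sym)) (Even∧Odd⇒≢ even-i odd-s+2 ∘ sym))

  embed : ℕ → ℕ
  embed i with i ≤? s
  ... | yes _ = i
  ... | no _  = 2 + i

  x⊂z : ∀ a b → IsProperSubseq m x M (z a b)
  x⊂z a b = m<n+m m (s≤s z≤n) , embed , embed-hits , embed-increasing
    where
    embed-hits : ∀ i → 1 ≤ i → i ≤ m → (1 ≤ embed i) × (embed i ≤ M) × (z a b (embed i) ≡ x i)
    embed-hits i 1≤i i≤m with i ≤? s
    ... | yes i≤s = 1≤i , ≤-trans i≤m (m≤n+m m 2) , insert2-before s a b x i≤s
    ... | no i≰s  = s≤s z≤n , s≤s (s≤s i≤m) , insert2-after s a b x (s≤s (s≤s (≰⇒> i≰s)))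

    embed-increasing : ∀ i j → 1 ≤ i → i < j → j ≤ m → embed i < embed j
    embed-increasing i j _ i<j _ with i ≤? s | j ≤? s
    ... | yes _   | yes _   = i<j
    ... | yes _   | no _    = <-≤-trans i<j (m≤n+m j 2)
    ... | no i≰s  | yes j≤s = ⊥-elim (<-asym (≰⇒> i≰s) (<-≤-trans i<j j≤s))
    ... | no _    | no _    = s≤s (s≤s i<j)

  -- decreases when a moves up or b moves down
  height : Pos n → Pos n → ℕ
  height a b = toℕ (row a) + (n ∸ toℕ (row b))

  no-admissible : ∀ a b → Acc _<_ (height a b) → ¬ Admissible a b
  no-admissible a b (acc smaller) adm =
    maximal (M , z a b , (z-traversal adm , z-tall (nothing-below , nothing-above)) , x⊂z a b)
    where
    nothing-below : ¬ (∃[ e ] IsOne P e × (b <v e) × (e <h a))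
    nothing-below (e , one-e , b<ᵥe , e<ₕa) =
      no-admissible a e (smaller (+-monoʳ-< (toℕ (row a)) (∸-monoʳ-< b<ᵥe (<⇒≤ (Fin.toℕ<n (row e))))))
                    (lower-b adm one-e b<ᵥe e<ₕa)
    nothing-above : ¬ (∃[ e ] IsOne P e × (e <v a) × (b <h e))
    nothing-above (e , one-e , e<ᵥa , b<ₕe) =
      no-admissible e b (smaller (+-monoˡ-< (n ∸ toℕ (row b)) e<ᵥa)) (raise-a adm one-e e<ᵥa b<ₕe)

  absurd : ⊥
  absurd = no-admissible y₁ y₂ (<-wellFounded _) initial

lemma4p1 : (n : ℕ) (P : Matrix01 n) → IsPermutationMatrix P →
    (m : ℕ) (x : Seq n) → IsMaximallyTall P m x → ¬ IsExtendable P m x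
lemma4p1 n P perm m x ((TX , tallX) , maximal)
         (s , (t , refl) , 5≤s , s≤m∸5 , y₁ , y₂ , one-y₁ , one-y₂ , TY) =
  Insertion.absurd perm TX tallX maximal (t + t) (t , refl) (≤-pred 5≤s) k+6≤m one-y₁ one-y₂
                   (subst (λ M → IsTraversal P M (insert2 s y₁ y₂ x)) (+-comm m 2) TY)
  where
  k+6≤m : 6 + (t + t) ≤ m
  k+6≤m = subst (_≤ m) (+-comm s 5)
            (m≤o∸n⇒m+n≤o s (<⇒≤ (m∸n≢0⇒n<m (>⇒≢ (≤-trans (s≤s z≤n) s≤m∸5)))) s≤m∸5)
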